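{- Let $K$ be the $3$-dimensional simplicial complex on the $12$ vertices $0,1,\dots,7,p_0,p_1,p_2,p_3$ whose $48$ tetrahedra are the following. Cone vertex $p_0$: $(0\,1\,4\,p_0),(2\,3\,7\,p_0),(1\,4\,5\,p_0),(2\,6\,7\,p_0),(0\,1\,2\,p_0),(4\,5\,7\,p_0),(1\,2\,3\,p_0),(4\,6\,7\,p_0),(0\,2\,4\,p_0),(1\,3\,7\,p_0),(2\,4\,6\,p_0),(1\,5\,7\,p_0)$. Cone vertex $p_1$: $(0\,2\,5\,p_1),(1\,3\,6\,p_1),(0\,5\,7\,p_1),(3\,4\,6\,p_1),(1\,5\,6\,p_1),(0\,3\,4\,p_1),(2\,5\,6\,p_1),(0\,3\,7\,p_1),(0\,2\,4\,p_1),(1\,3\,7\,p_1),(2\,4\,6\,p_1),(1\,5\,7\,p_1)$. Cone vertex $p_2$: $(0\,1\,4\,p_2),(2\,3\,7\,p_2),(1\,4\,5\,p_2),(2\,6\,7\,p_2),(1\,5\,6\,p_2),(0\,3\,4\,p_2),(2\,5\,6\,p_2),(0\,3\,7\,p_2),(0\,1\,6\,p_2),(2\,3\,5\,p_2),(0\,6\,7\,p_2),(3\,4\,5\,p_2)$. Cone vertex $p_3$: $(0\,2\,5\,p_3),(1\,3\,6\,p_3),(0\,5\,7\,p_3),(3\,4\,6\,p_3),(0\,1\,2\,p_3),(4\,5\,7\,p_3),(1\,2\,3\,p_3),(4\,6\,7\,p_3),(0\,1\,6\,p_3),(2\,3\,5\,p_3),(0\,6\,7\,p_3),(3\,4\,5\,p_3)$.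 Then $K$, which is a $12$-vertex equilibrium triangulation of $\mathbb{R}P^3$, is a subdivision of the $24$-cell under antipodal identification. That is, $K$ is obtained from the polyhedral complex given by the boundary complex of the $24$-cell modulo the antipodal map by subdividing its cells (each pair of tetrahedra of $K$ forming a pyramid over a triangulated square, and each two such pyramids over the same square forming one octahedron of the $24$-cell quotient).
   Context: The vertices $0,\dots,7$ arise from the $16$ vertices of the $4$-cube $[0,1]^4$ after antipodal identification, where vertex labels are the cube coordinates read in binary. The vertex $p_i$ is the centre of the $i$-th of the four $3$-cubes into which the boundary of the $4$-cube decomposes modulo antipodal identification. For $\mathbb{R}P^3$, the equilibrium subsets are $B_i=\{[x_0,\dots,x_3] : |x_i|\ge|x_j| \ \forall j\}$ and their intersections. An equilibrium triangulation is a combinatorial triangulation realising all of these as subcomplexes. The $24$-cell is the regular convex $4$-polytope with Schläfli symbol $\{3,4,3\}$. It has $24$ vertices and $24$ octahedral facets and is centrally symmetric. -}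

module Defs where

open import Data.Integer using (ℤ; +_; -_; _+_; _*_; -[1+_])
open import Data.Fin using (Fin; #_)
open import Data.Fin.Subset using (Subset; _∈_; _⊆_; ∣_∣; ⁅_⁆; _∪_)
open import Data.Vec using (Vec; []; _∷_; zipWith; map; foldr; lookup; replicate; updateAt)
open import Data.Nat using (ℕ)
open import Data.List using (List; []; _∷_)
import Data.List.Membership.Propositional as L
open import Data.Product using (Σ; ∃; ∃-syntax; _×_; _,_)
open import Data.Sum using (_⊎_)
open import Relation.Binary.PropositionalEquality using (_≡_; _≢_)
open import Function.Bundles using (_⇔_)

V4 : Set
V4 = Vec ℤ 4

_⊕_ : V4 → V4 → V4
_⊕_ = zipWith _+_

infixl 6 _⊕_
infixl 7 _⊙_

_⊙_ : ℤ → V4 → V4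
s ⊙ v = map (s *_) v

neg : V4 → V4
neg = map -_

dot : V4 → V4 → ℤ
dot u v = foldr (λ _ → ℤ) _+_ (+ 0) (zipWith _*_ u v)

e : Fin 4 → V4
e i = updateAt (replicate 4 (+ 0)) i (λ _ → + 1)

IsSign : ℤ → Set
IsSign s = s ≡ + 1 ⊎ s ≡ -[1+ 0 ]

-- The 24-cell, in the standard coordinates scaled by 2:
-- vertices are the 16 points (±1,±1,±1,±1) and the 8 points ±2eᵢ
-- (the vertices of the 4-cube [-1,1]⁴ together with the centres ±2eᵢ
-- of the pyramids over its eight 3-cubes); its 24 octahedral facets
-- are {x : ⟨x,n⟩ = 2} for the 24 normals n = s·eᵢ + t·eⱼ (i ≠ j, s,t = ±1).

IsVertex24 : V4 → Set
IsVertex24 v =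
  (∀ i → IsSign (lookup v i))
  ⊎ (∃[ i ] ∃[ s ] (IsSign s × v ≡ (s * + 2) ⊙ e i))

IsFacetNormal24 : V4 → Set
IsFacetNormal24 n =
  ∃[ i ] ∃[ j ] ∃[ s ] ∃[ t ]
    (i ≢ j × IsSign s × IsSign t × n ≡ (s ⊙ e i) ⊕ (t ⊙ e j))

InFacet : V4 → V4 → Set
InFacet n v = dot v n ≡ + 2

-- Modulo the antipodal map x ↦ -x: the vertex class [v] = {v,-v} lies in
-- the facet class [F_n] = {F_n, F_{-n}} iff v or -v lies in F_n.
InFacetClass : V4 → V4 → Set
InFacetClass n v = InFacet n v ⊎ InFacet n (neg v)

-- The vertex classes [v], [w] are opposite (non-adjacent) vertices of the
-- octahedron [F_n]: lifts ±v, ±w lying in F_n are opposite vertices of the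
-- octahedron F_n, i.e. they sum to twice its centre n.
OppositeIn : V4 → V4 → V4 → Set
OppositeIn n v w =
  ∃[ s ] ∃[ t ] (IsSign s × IsSign t ×
    InFacet n (s ⊙ v) × InFacet n (t ⊙ w) × (s ⊙ v) ⊕ (t ⊙ w) ≡ + 2 ⊙ n)

p₀ p₁ p₂ p₃ : Fin 12
p₀ = # 8
p₁ = # 9
p₂ = # 10
p₃ = # 11

tet : Fin 12 → Fin 12 → Fin 12 → Fin 12 → Subset 12
tet a b c d = ⁅ a ⁆ ∪ ⁅ b ⁆ ∪ ⁅ c ⁆ ∪ ⁅ d ⁆

Ktets : List (Subset 12)
Ktets =
  tet (# 0) (# 1) (# 4) p₀ ∷ tet (# 2) (# 3) (# 7) p₀ ∷ tet (# 1) (# 4) (# 5) p₀ ∷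
  tet (# 2) (# 6) (# 7) p₀ ∷ tet (# 0) (# 1) (# 2) p₀ ∷ tet (# 4) (# 5) (# 7) p₀ ∷
  tet (# 1) (# 2) (# 3) p₀ ∷ tet (# 4) (# 6) (# 7) p₀ ∷ tet (# 0) (# 2) (# 4) p₀ ∷
  tet (# 1) (# 3) (# 7) p₀ ∷ tet (# 2) (# 4) (# 6) p₀ ∷ tet (# 1) (# 5) (# 7) p₀ ∷
  tet (# 0) (# 2) (# 5) p₁ ∷ tet (# 1) (# 3) (# 6) p₁ ∷ tet (# 0) (# 5) (# 7) p₁ ∷
  tet (# 3) (# 4) (# 6) p₁ ∷ tet (# 1) (# 5) (# 6) p₁ ∷ tet (# 0) (# 3) (# 4) p₁ ∷
  tet (# 2) (# 5) (# 6) p₁ ∷ tet (# 0) (# 3) (# 7) p₁ ∷ tet (# 0) (# 2) (# 4) p₁ ∷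
  tet (# 1) (# 3) (# 7) p₁ ∷ tet (# 2) (# 4) (# 6) p₁ ∷ tet (# 1) (# 5) (# 7) p₁ ∷
  tet (# 0) (# 1) (# 4) p₂ ∷ tet (# 2) (# 3) (# 7) p₂ ∷ tet (# 1) (# 4) (# 5) p₂ ∷
  tet (# 2) (# 6) (# 7) p₂ ∷ tet (# 1) (# 5) (# 6) p₂ ∷ tet (# 0) (# 3) (# 4) p₂ ∷
  tet (# 2) (# 5) (# 6) p₂ ∷ tet (# 0) (# 3) (# 7) p₂ ∷ tet (# 0) (# 1) (# 6) p₂ ∷
  tet (# 2) (# 3) (# 5) p₂ ∷ tet (# 0) (# 6) (# 7) p₂ ∷ tet (# 3) (# 4) (# 5) p₂ ∷
  tet (# 0) (# 2) (# 5) p₃ ∷ tet (# 1) (# 3) (# 6) p₃ ∷ tet (# 0) (# 5) (# 7) p₃ ∷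
  tet (# 3) (# 4) (# 6) p₃ ∷ tet (# 0) (# 1) (# 2) p₃ ∷ tet (# 4) (# 5) (# 7) p₃ ∷
  tet (# 1) (# 2) (# 3) p₃ ∷ tet (# 4) (# 6) (# 7) p₃ ∷ tet (# 0) (# 1) (# 6) p₃ ∷
  tet (# 2) (# 3) (# 5) p₃ ∷ tet (# 0) (# 6) (# 7) p₃ ∷ tet (# 3) (# 4) (# 5) p₃ ∷
  []

-- "The simplicial complex with facet list Ts on vertex set Fin 12 is a
-- subdivision (without new vertices) of ∂(24-cell)/±, via the vertex
-- identification ψ (k ↦ the class [ψ k])."
--
-- * ψ induces a bijection from Fin 12 onto the 12 antipodal vertex classes;
-- * every tetrahedron lies in (the vertex set of) some octahedron class;
-- * for every octahedron class [F_n], the tetrahedra of the complex lying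
--   in it are exactly the tetrahedra of a triangulation of the octahedron:
--   there is an opposite pair {a,b} (the common diagonal of the square
--   along which the octahedron splits into two pyramids, each split into
--   two tetrahedra), and the tetrahedra in [F_n] are precisely the 4-subsets
--   of [F_n] containing a and b and no other opposite pair.

record SubdivisionVia (Ts : List (Subset 12)) (ψ : Fin 12 → V4) : Set where
  field
    vertex     : ∀ k → IsVertex24 (ψ k)
    injective  : ∀ k l → (ψ k ≡ ψ l ⊎ ψ k ≡ neg (ψ l)) → k ≡ l
    surjective : ∀ v → IsVertex24 v → ∃[ k ] (ψ k ≡ v ⊎ ψ k ≡ neg v)
    covered    : ∀ T → T L.∈ Ts →
                   ∃[ n ] (IsFacetNormal24 n × (∀ k → k ∈ T → InFacetClass n (ψ k)))
    tiled      : ∀ n → IsFacetNormal24 n →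
                   ∃[ a ] ∃[ b ] (a ≢ b × OppositeIn n (ψ a) (ψ b) ×
                     (∀ T →
                       ((T L.∈ Ts) × (∀ k → k ∈ T → InFacetClass n (ψ k)))
                       ⇔ (∣ T ∣ ≡ 4 × (∀ k → k ∈ T → InFacetClass n (ψ k)) ×
                          a ∈ T × b ∈ T ×
                          (∀ k l → k ∈ T → l ∈ T → OppositeIn n (ψ k) (ψ l) →
                             (k ≡ a × l ≡ b) ⊎ (k ≡ b × l ≡ a)))))

IsSubdivisionOf24CellModAntipodal : List (Subset 12) → Set
IsSubdivisionOf24CellModAntipodal Ts = Σ (Fin 12 → V4) (SubdivisionVia Ts)

-- Identify vertex k ≤ 7 with the class of the cube vertex (x₀,x₁,x₂,-1), where xᵢ = +1 or -1
-- according as binary digit i of k is 1 or 0, and p₀,…,p₃ with the classes of 2e₃, 2e₀, 2e₁, 2e₂.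
-- Every quantifier of the statement then ranges, up to this encoding, over finitely many signs,
-- axes, labels and vertex sets, so each clause is decided by evaluation. For the tiling clause,
-- a tetrahedron of K in an octahedron and a tetrahedron of the octahedron's split along a diagonal
-- both lie among its six vertices, so the two families are compared on 64 subsets only; the
-- diagonal itself is found by search.

module Submission where

open import Defs
import Data.Bool as Bool
open import Data.Integer using (ℤ; +_; 1ℤ; -1ℤ; _*_)
import Data.Integer.Properties as ℤ
open import Data.Fin using (Fin; zero; suc; #_)
open import Data.Fin.Properties using (all?; any?) renaming (_≟_ to _≟ᶠ_)
open import Data.Fin.Subset using (Subset; _∈_; ∣_∣; inside; outside)
open import Data.Fin.Subset.Properties using (_∈?_)
open import Data.Vec using (Vec; []; _∷_; lookup; here; there)
open import Data.Vec.Properties using (≡-dec)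
import Data.Nat as ℕ
open import Data.Nat.Properties using () renaming (_≟_ to _≟ⁿ_)
open import Data.List using (List)
import Data.List.Relation.Unary.All as All
import Data.List.Membership.Propositional as L
open import Data.List.Membership.DecPropositional (≡-dec {n = 12} Bool._≟_) using () renaming (_∈?_ to _∈ˡ?_)
open import Data.Product using (∃; ∃-syntax; _×_; _,_; proj₁; proj₂)
open import Data.Sum using (_⊎_; inj₁; inj₂)
open import Relation.Nullary using (Dec; ¬?; map′; _×-dec_; _⊎-dec_; _→-dec_)
open import Relation.Nullary.Decidable using (from-yes)
open import Relation.Unary using (Decidable)
open import Relation.Binary.PropositionalEquality using (_≡_; _≢_; refl)
open import Function using (_∘_)
open import Function.Bundles using (_⇔_; mk⇔; Equivalence)

infix 4 _≟ᵛ_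

_≟ᵛ_ : (u v : V4) → Dec (u ≡ v)
_≟ᵛ_ = ≡-dec ℤ._≟_

IsSign? : Decidable IsSign
IsSign? s = (s ℤ.≟ 1ℤ) ⊎-dec (s ℤ.≟ -1ℤ)

∀-sign? : {P : ℤ → Set} → Decidable P → Dec (∀ s → IsSign s → P s)
∀-sign? P? = map′ (λ (p₊ , p₋) → λ { _ (inj₁ refl) → p₊ ; _ (inj₂ refl) → p₋ })
                  (λ h → h 1ℤ (inj₁ refl) , h -1ℤ (inj₂ refl))
                  (P? 1ℤ ×-dec P? -1ℤ)

∃-sign? : {P : ℤ → Set} → Decidable P → Dec (∃[ s ] (IsSign s × P s))
∃-sign? P? = map′ (λ { (inj₁ p) → 1ℤ , inj₁ refl , p ; (inj₂ p) → -1ℤ , inj₂ refl , p })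
                  (λ { (_ , inj₁ refl , p) → inj₁ p ; (_ , inj₂ refl , p) → inj₂ p })
                  (P? 1ℤ ⊎-dec P? -1ℤ)

Within : ∀ {n} → (Fin n → Set) → Subset n → Set
Within M T = ∀ k → k ∈ T → M k

∀-subset? : ∀ {n} {M : Fin n → Set} {P : Subset n → Set} →
            Decidable M → Decidable P → Dec (∀ T → Within M T → P T)
∀-subset? {ℕ.zero} M? P? = map′ (λ p → λ { [] _ → p }) (λ h → h [] λ _ ()) (P? [])
∀-subset? {ℕ.suc n} M? P? = map′
  (λ { (outs , ins) (outside ∷ T) w → outs T (λ k k∈T → w (suc k) (there k∈T))
     ; (outs , ins) (inside ∷ T) w → ins (w zero here) T (λ k k∈T → w (suc k) (there k∈T)) })
  (λ h → (λ T w → h (outside ∷ T) (λ { (suc k) (there k∈T) → w k k∈T }))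
       , (λ m T w → h (inside ∷ T) (λ { zero here → m ; (suc k) (there k∈T) → w k k∈T })))
  (∀-subset? (M? ∘ suc) (P? ∘ (outside ∷_))
   ×-dec (M? zero →-dec ∀-subset? (M? ∘ suc) (P? ∘ (inside ∷_))))

∀-∈? : ∀ {A : Set} {P : A → Set} → Decidable P → (xs : List A) → Dec (∀ x → x L.∈ xs → P x)
∀-∈? P? xs = map′ (λ all x → All.lookup all) (λ h → All.tabulate (h _)) (All.all? P? xs)

Within? : ∀ {n} {M : Fin n → Set} → Decidable M → Decidable (Within M)
Within? M? T = all? λ k → k ∈? T →-dec M? k

∀-vertex24? : {P : V4 → Set} → Decidable P → Dec (∀ v → IsVertex24 v → P v)
∀-vertex24? {P} P? = map′ to from (∀-cubeVertex? ×-dec ∀-axisVertex?)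
  where
  OnCube OnAxes : Set
  OnCube = ∀ v → (∀ i → IsSign (lookup v i)) → P v
  OnAxes = ∀ i s → IsSign s → P ((s * + 2) ⊙ e i)

  ∀-cubeVertex? : Dec OnCube
  ∀-cubeVertex? = map′
    (λ h → λ { (a ∷ b ∷ c ∷ d ∷ []) s → h a (s zero) b (s (# 1)) c (s (# 2)) d (s (# 3)) })
    (λ h a sa b sb c sc d sd → h _ λ { zero → sa ; (suc zero) → sb
                                      ; (suc (suc zero)) → sc ; (suc (suc (suc zero))) → sd })
    (∀-sign? λ a → ∀-sign? λ b → ∀-sign? λ c → ∀-sign? λ d → P? (a ∷ b ∷ c ∷ d ∷ []))

  ∀-axisVertex? : Dec OnAxes
  ∀-axisVertex? = all? λ i → ∀-sign? λ s → P? ((s * + 2) ⊙ e i)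

  to : OnCube × OnAxes → ∀ v → IsVertex24 v → P v
  to (cube , axes) v (inj₁ s) = cube v s
  to (cube , axes) _ (inj₂ (i , s , sgn , refl)) = axes i s sgn

  from : (∀ v → IsVertex24 v → P v) → OnCube × OnAxes
  from h = (λ v s → h v (inj₁ s)) , (λ i s sgn → h _ (inj₂ (i , s , sgn , refl)))

IsVertex24? : Decidable IsVertex24
IsVertex24? v =
  all? (λ i → IsSign? (lookup v i)) ⊎-dec any? (λ i → ∃-sign? λ s → v ≟ᵛ (s * + 2) ⊙ e i)

∃-facetNormal24? : {P : V4 → Set} → Decidable P → Dec (∃[ n ] (IsFacetNormal24 n × P n))
∃-facetNormal24? P? = map′
  (λ { (i , j , i≢j , s , sgnₛ , t , sgnₜ , p) → _ , (i , j , s , t , i≢j , sgnₛ , sgnₜ , refl) , p })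
  (λ { (_ , (i , j , s , t , i≢j , sgnₛ , sgnₜ , refl) , p) → i , j , i≢j , s , sgnₛ , t , sgnₜ , p })
  (any? λ i → any? λ j → ¬? (i ≟ᶠ j) ×-dec ∃-sign? λ s → ∃-sign? λ t → P? (s ⊙ e i ⊕ t ⊙ e j))

InFacet? : ∀ n v → Dec (InFacet n v)
InFacet? n v = dot v n ℤ.≟ + 2

InFacetClass? : ∀ n v → Dec (InFacetClass n v)
InFacetClass? n v = InFacet? n v ⊎-dec InFacet? n (neg v)

OppositeIn? : ∀ n v w → Dec (OppositeIn n v w)
OppositeIn? n v w = map′
  (λ { (s , sgnₛ , t , sgnₜ , p) → s , t , sgnₛ , sgnₜ , p })
  (λ { (s , t , sgnₛ , sgnₜ , p) → s , sgnₛ , t , sgnₜ , p })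
  (∃-sign? λ s → ∃-sign? λ t →
    InFacet? n (s ⊙ v) ×-dec InFacet? n (t ⊙ w) ×-dec s ⊙ v ⊕ t ⊙ w ≟ᵛ + 2 ⊙ n)

ψ : Fin 12 → V4
ψ k = lookup table k
  where
  table : Vec V4 12
  table =
    (-1ℤ ∷ -1ℤ ∷ -1ℤ ∷ -1ℤ ∷ []) ∷ (1ℤ ∷ -1ℤ ∷ -1ℤ ∷ -1ℤ ∷ []) ∷
    (-1ℤ ∷ 1ℤ ∷ -1ℤ ∷ -1ℤ ∷ []) ∷ (1ℤ ∷ 1ℤ ∷ -1ℤ ∷ -1ℤ ∷ []) ∷
    (-1ℤ ∷ -1ℤ ∷ 1ℤ ∷ -1ℤ ∷ []) ∷ (1ℤ ∷ -1ℤ ∷ 1ℤ ∷ -1ℤ ∷ []) ∷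
    (-1ℤ ∷ 1ℤ ∷ 1ℤ ∷ -1ℤ ∷ []) ∷ (1ℤ ∷ 1ℤ ∷ 1ℤ ∷ -1ℤ ∷ []) ∷
    (+ 0 ∷ + 0 ∷ + 0 ∷ + 2 ∷ []) ∷ (+ 2 ∷ + 0 ∷ + 0 ∷ + 0 ∷ []) ∷
    (+ 0 ∷ + 2 ∷ + 0 ∷ + 0 ∷ []) ∷ (+ 0 ∷ + 0 ∷ + 2 ∷ + 0 ∷ []) ∷ []

ψ-vertex : ∀ k → IsVertex24 (ψ k)
ψ-vertex = from-yes (all? (IsVertex24? ∘ ψ))

ψ-injective : ∀ k l → (ψ k ≡ ψ l ⊎ ψ k ≡ neg (ψ l)) → k ≡ l
ψ-injective = from-yes (all? λ k → all? λ l → (ψ k ≟ᵛ ψ l ⊎-dec ψ k ≟ᵛ neg (ψ l)) →-dec k ≟ᶠ l)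

ψ-surjective : ∀ v → IsVertex24 v → ∃[ k ] (ψ k ≡ v ⊎ ψ k ≡ neg v)
ψ-surjective = from-yes (∀-vertex24? λ v → any? λ k → ψ k ≟ᵛ v ⊎-dec ψ k ≟ᵛ neg v)

InFacetClassOf : V4 → Fin 12 → Set
InFacetClassOf n k = InFacetClass n (ψ k)

InFacetClassOf? : ∀ n → Decidable (InFacetClassOf n)
InFacetClassOf? n k = InFacetClass? n (ψ k)

K-covered : ∀ T → T L.∈ Ktets → ∃[ n ] (IsFacetNormal24 n × Within (InFacetClassOf n) T)
K-covered = from-yes (∀-∈? (λ T → ∃-facetNormal24? λ n → Within? (InFacetClassOf? n) T) Ktets)

OnlyOppositePair : V4 → Fin 12 → Fin 12 → Subset 12 → Set
OnlyOppositePair n a b T =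
  ∀ k l → k ∈ T → l ∈ T → OppositeIn n (ψ k) (ψ l) → (k ≡ a × l ≡ b) ⊎ (k ≡ b × l ≡ a)

OnlyOppositePair? : ∀ n a b → Decidable (OnlyOppositePair n a b)
OnlyOppositePair? n a b T = all? λ k → all? λ l →
  k ∈? T →-dec l ∈? T →-dec OppositeIn? n (ψ k) (ψ l) →-dec
    ((k ≟ᶠ a ×-dec l ≟ᶠ b) ⊎-dec (k ≟ᶠ b ×-dec l ≟ᶠ a))

KTetrahedronIn : V4 → Subset 12 → Set
KTetrahedronIn n T = T L.∈ Ktets × Within (InFacetClassOf n) T

DiagonalTetrahedron : V4 → Fin 12 → Fin 12 → Subset 12 → Set
DiagonalTetrahedron n a b T =
  ∣ T ∣ ≡ 4 × Within (InFacetClassOf n) T × a ∈ T × b ∈ T × OnlyOppositePair n a b T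

KTriangulatesAlong : V4 → Fin 12 → Fin 12 → Set
KTriangulatesAlong n a b = ∀ T → KTetrahedronIn n T ⇔ DiagonalTetrahedron n a b T

DiagonalTetrahedron? : ∀ n a b → Decidable (DiagonalTetrahedron n a b)
DiagonalTetrahedron? n a b T = ∣ T ∣ ≟ⁿ 4 ×-dec Within? (InFacetClassOf? n) T
  ×-dec a ∈? T ×-dec b ∈? T ×-dec OnlyOppositePair? n a b T

KTriangulatesAlong? : ∀ n a b → Dec (KTriangulatesAlong n a b)
KTriangulatesAlong? n a b = map′
  (λ (sound , complete) T → mk⇔ (λ (T∈K , w) → sound T T∈K w)
                                (λ t → complete T (proj₁ (proj₂ t)) t , proj₁ (proj₂ t)))
  (λ h → (λ T T∈K w → Equivalence.to (h T) (T∈K , w))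
       , (λ T _ t → proj₁ (Equivalence.from (h T) t)))
  (∀-∈? (λ T → Within? (InFacetClassOf? n) T →-dec DiagonalTetrahedron? n a b T) Ktets
   ×-dec ∀-subset? (InFacetClassOf? n) (λ T → DiagonalTetrahedron? n a b T →-dec T ∈ˡ? Ktets))
KTriangulatesFacet : V4 → Set
KTriangulatesFacet n = ∃[ a ] ∃[ b ] (a ≢ b × OppositeIn n (ψ a) (ψ b) × KTriangulatesAlong n a b)

KTriangulatesFacet? : Decidable KTriangulatesFacet
KTriangulatesFacet? n = any? λ a → any? λ b →
  ¬? (a ≟ᶠ b) ×-dec OppositeIn? n (ψ a) (ψ b) ×-dec KTriangulatesAlong? n a b

KTriangulatesFacetsOnAxis : Fin 4 → Set
KTriangulatesFacetsOnAxis i =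
  ∀ j → i ≢ j → ∀ s → IsSign s → ∀ t → IsSign t → KTriangulatesFacet (s ⊙ e i ⊕ t ⊙ e j)

KTriangulatesFacetsOnAxis? : Decidable KTriangulatesFacetsOnAxis
KTriangulatesFacetsOnAxis? i = all? λ j → ¬? (i ≟ᶠ j) →-dec
  ∀-sign? λ s → ∀-sign? λ t → KTriangulatesFacet? (s ⊙ e i ⊕ t ⊙ e j)

-- One evaluation per axis: deciding all 24 facets at once exhausts the type checker's memory.
kTriangulatesFacetsOnAxis : ∀ i → KTriangulatesFacetsOnAxis i
kTriangulatesFacetsOnAxis zero = from-yes (KTriangulatesFacetsOnAxis? zero)
kTriangulatesFacetsOnAxis (suc zero) = from-yes (KTriangulatesFacetsOnAxis? (suc zero))
kTriangulatesFacetsOnAxis (suc (suc zero)) = from-yes (KTriangulatesFacetsOnAxis? (suc (suc zero)))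
kTriangulatesFacetsOnAxis (suc (suc (suc zero))) = from-yes (KTriangulatesFacetsOnAxis? (suc (suc (suc zero))))

K-tiled : ∀ n → IsFacetNormal24 n → KTriangulatesFacet n
K-tiled _ (i , j , s , t , i≢j , sgnₛ , sgnₜ , refl) =
  kTriangulatesFacetsOnAxis i j i≢j s sgnₛ t sgnₜ

theorem4p6 : IsSubdivisionOf24CellModAntipodal Ktets
theorem4p6 = ψ , record
  { vertex     = ψ-vertex
  ; injective  = ψ-injective
  ; surjective = ψ-surjective
  ; covered    = K-covered
  ; tiled      = K-tiled
  }
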